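{- Let $S$ be as in the context, with the neighbours of $s_n$ being $s_{j_1},\dots,s_{j_m}$. Then $$\sum_{\overline i\in\Pi_0}\overline i=\sum_{k=1}^m\widetilde s_{j_k}.$$
   Context: $S$ is a finite simple connected graph with vertex set $\{s_1,\dots,s_n\}$, $n\ge2$, and edge set $R$, such that $s_1,\dots,s_{n-1}$ is an induced path; the neighbours of $s_n$ are $s_{j_1},\dots,s_{j_m}$ with $1\le j_1<\dots<j_m\le n-1$. $\widetilde s$ is the characteristic vector in $F_2^n$ (coordinates indexed by vertices) of vertex $s$. The flipping move of $s$ is $\mathbf s\in\mathrm{Mat}_n(F_2)$ with $\mathbf s_{ab}=1$ if $a=b$, or if $b=s$ and $ab\in R$, and $0$ otherwise. $\overline1=\widetilde s_1$ and $\overline{i+1}=\mathbf{s_i}\cdots\mathbf{s_1}\overline1$ for $1\le i\le n-1$. $\Pi=\{\overline1,\dots,\overline n\}$ and $\Pi_0=\{\overline i\in\Pi:\langle\overline i,\widetilde s_n\rangle=0\}$ (dot product over $F_2$). -}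

module Defs where

open import Data.List using (List; []; _∷_; take; allFin)

open import Data.Nat using (ℕ; zero; suc; _<_)
open import Data.Fin using (Fin; zero; suc; toℕ; fromℕ; inject₁; _≟_)
open import Data.Bool using (Bool; true; false; _xor_; _∧_; if_then_else_)
open import Data.Product using (_×_)
open import Data.Sum using (_⊎_)
open import Relation.Binary.PropositionalEquality using (_≡_)
open import Relation.Nullary using (¬_; does)

-- F₂ is modelled by Bool (xor = addition, ∧ = multiplication).
-- Vectors in F₂^n and n×n matrices over F₂.
Vec₂ : ℕ → Set
Vec₂ n = Fin n → Bool

Mat₂ : ℕ → Set
Mat₂ n = Fin n → Fin n → Bool

sumF : ∀ {n} → (Fin n → Bool) → Bool
sumF {zero}  f = false
sumF {suc n} f = f zero xor sumF (λ i → f (suc i))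

sumV : ∀ {n m} → (Fin n → Vec₂ m) → Vec₂ m
sumV {zero}  f = λ _ → false
sumV {suc n} f = λ a → f zero a xor sumV (λ i → f (suc i)) a

_+ᵥ_ : ∀ {n} → Vec₂ n → Vec₂ n → Vec₂ n
(u +ᵥ v) a = u a xor v a

_·ᵥ_ : ∀ {n} → Bool → Vec₂ n → Vec₂ n
(c ·ᵥ v) a = c ∧ v a

zeroV : ∀ {n} → Vec₂ n
zeroV _ = false

charVec : ∀ {n} → Fin n → Vec₂ n
charVec s a = does (a ≟ s)

dot : ∀ {n} → Vec₂ n → Vec₂ n → Bool
dot u v = sumF (λ a → u a ∧ v a)

_·ₘ_ : ∀ {n} → Mat₂ n → Mat₂ n → Mat₂ n
(M ·ₘ N) a b = sumF (λ c → M a c ∧ N c b)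

_·_ : ∀ {n} → Mat₂ n → Vec₂ n → Vec₂ n
(M · v) a = sumF (λ b → M a b ∧ v b)

idMat : ∀ {n} → Mat₂ n
idMat a b = does (a ≟ b)

Adj : ℕ → Set
Adj n = Fin n → Fin n → Bool

IsSimple : ∀ {n} → Adj n → Set
IsSimple {n} R = (∀ a b → R a b ≡ R b a) × (∀ a → R a a ≡ false)

data Reach {n} (R : Adj n) : Fin n → Fin n → Set where
  here : ∀ {a} → Reach R a a
  step : ∀ {a b c} → R a b ≡ true → Reach R b c → Reach R a c

Connected : ∀ {n} → Adj n → Set
Connected {n} R = ∀ a b → Reach R a b

-- The vertex s_{i+1} of the paper is  i : Fin n  (0-based indices);
-- for n = suc (suc k) the last vertex s_n is  fromℕ (suc k).
-- s_1,…,s_{n-1} (indices 0..k) form an induced path: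
-- for i, j < n-1, i ~ j  iff  |i - j| = 1.
InducedPath : ∀ k → Adj (suc (suc k)) → Set
InducedPath k R = ∀ (i j : Fin (suc (suc k))) → toℕ i < suc k → toℕ j < suc k →
  (R i j ≡ true → (toℕ j ≡ suc (toℕ i) ⊎ toℕ i ≡ suc (toℕ j))) ×
  ((toℕ j ≡ suc (toℕ i) ⊎ toℕ i ≡ suc (toℕ j)) → R i j ≡ true)

flipMat : ∀ {n} → Adj n → Fin n → Mat₂ n
flipMat R s a b = does (a ≟ b) Data.Bool.∨ (does (b ≟ s) ∧ R a b)
  where import Data.Bool

-- prodFlip R [v₁,…,v_t] = flip(v_t) ⋯ flip(v₁)
prodFlip : ∀ {n} → Adj n → List (Fin n) → Mat₂ n
prodFlip R []       = idMat
prodFlip R (v ∷ vs) = prodFlip R vs ·ₘ flipMat R v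

-- Π: the paper's  \overline{t+1} = 𝐬_t ⋯ 𝐬_1 \overline 1,  \overline 1 = s̃₁,
-- indexed by t : Fin n (0-based);  s_1,…,s_t are the vertices with indices 0..t-1.
bar : ∀ {n} → Adj (suc n) → Fin (suc n) → Vec₂ (suc n)
bar {n} R t = prodFlip R (take (toℕ t) (allFin (suc n))) · charVec zero

-- Index the path by α = 0, …, n-2 and let e_α be the characteristic vector of s_{α+1}.
-- As \overline{t+1} has a 1 at position t, the flip of s_{t+1} adds column t of the
-- adjacency matrix, which on the induced path is e_{t-1} + e_{t+1}; so by induction
-- \overline{t+1} agrees with e_{t-1} + e_t on the path. In the sum over Π₀ the last
-- coordinate vanishes by the definition of Π₀, and the coordinate of s_{α+1} only receives
-- the terms t = α, α + 1, giving (1 + c_α) + (1 + c_{α+1}) with c_t = ⟨\overline{t+1}, s̃_n⟩;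
-- the same flip of s_{α+1} shows that c_{α+1} + c_α is the adjacency of s_{α+1} and s_n.
module Submission where

open import Defs
open import Data.Nat using (ℕ; suc)
open import Data.Fin using (Fin; fromℕ)
open import Data.Bool using (Bool; true; false; if_then_else_)
open import Relation.Binary.PropositionalEquality using (_≡_)

open import Algebra using (CommutativeRing)
open import Data.Bool using (_xor_; _∧_; not)
open import Data.Bool.Properties
  using ( ∧-comm; ∧-assoc; ∧-zeroʳ; ∧-identityʳ; ∧-inverseˡ; ∧-distribˡ-xor; ∧-distribʳ-xor
        ; xor-identityʳ; xor-same; xor-∧-commutativeRing; if-float )
open import Data.Nat using (zero; _≤_; _<_; s≤s)
import Data.Nat.Properties as ℕ
open import Data.Fin using (zero; suc; toℕ; fromℕ<; _≟_)
open import Data.Fin.Properties using (toℕ<n; toℕ-fromℕ; toℕ-fromℕ<; toℕ-injective)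
open import Data.List using (List; []; _∷_; _++_; take; allFin)
open import Data.List.Properties using (take-suc-tabulate)
open import Data.Product using (_×_; _,_; proj₁; proj₂)
open import Data.Sum as Sum using (_⊎_; inj₁; inj₂)
open import Data.Empty using (⊥-elim)
open import Function using (id; _∘_)
open import Relation.Binary.PropositionalEquality
  using (refl; sym; trans; cong; cong₂; module ≡-Reasoning)
open import Relation.Nullary using (Dec; yes; no; does; ¬_; contradiction)
open import Relation.Nullary.Decidable using (dec-true; dec-false)
open import Algebra.Properties.CommutativeSemigroup
  (CommutativeRing.+-commutativeSemigroup xor-∧-commutativeRing) using (interchange)

open ≡-Reasoning

if-then-false : ∀ b x → (if b then false else x) ≡ not b ∧ x
if-then-false false x = refl
if-then-false true  x = refl

if-else-false : ∀ b x → (if b then x else false) ≡ b ∧ x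
if-else-false false x = refl
if-else-false true  x = refl

not-xor-xor-not : ∀ x y → not (x xor y) xor not x ≡ y
not-xor-xor-not false false = refl
not-xor-xor-not false true  = refl
not-xor-xor-not true  false = refl
not-xor-xor-not true  true  = refl

≡-does-xor-does : ∀ {a b} {A : Set a} {B : Set b} (x : Bool) (A? : Dec A) (B? : Dec B) →
  (x ≡ true → A ⊎ B) → (A ⊎ B → x ≡ true) → ¬ (A × B) → x ≡ does A? xor does B?
≡-does-xor-does x     (yes a) (yes b) _  _    exclusive = contradiction (a , b) exclusive
≡-does-xor-does x     (yes a) (no _)  _  A⊎B⇒ _   = A⊎B⇒ (inj₁ a)
≡-does-xor-does x     (no _)  (yes b) _  A⊎B⇒ _   = A⊎B⇒ (inj₂ b)
≡-does-xor-does false (no _)  (no _)  _  _    _   = refl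
≡-does-xor-does true  (no ¬a) (no ¬b) ⇒A⊎B _ _   = ⊥-elim (Sum.[ ¬a , ¬b ] (⇒A⊎B refl))

sumF-cong : ∀ {n} {f g : Fin n → Bool} → (∀ i → f i ≡ g i) → sumF f ≡ sumF g
sumF-cong {zero}  f≗g = refl
sumF-cong {suc n} f≗g = cong₂ _xor_ (f≗g zero) (sumF-cong (f≗g ∘ suc))

sumF-false : ∀ n → sumF {n} (λ _ → false) ≡ false
sumF-false zero    = refl
sumF-false (suc n) = sumF-false n

sumF-xor : ∀ {n} (f g : Fin n → Bool) → sumF (λ i → f i xor g i) ≡ sumF f xor sumF g
sumF-xor {zero}  f g = refl
sumF-xor {suc n} f g =
  trans (cong ((f zero xor g zero) xor_) (sumF-xor (f ∘ suc) (g ∘ suc)))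
        (interchange (f zero) (g zero) (sumF (f ∘ suc)) (sumF (g ∘ suc)))

∧-sumF : ∀ {n} x (f : Fin n → Bool) → x ∧ sumF f ≡ sumF (λ i → x ∧ f i)
∧-sumF {zero}  x f = ∧-zeroʳ x
∧-sumF {suc n} x f = trans (∧-distribˡ-xor x (f zero) _) (cong ((x ∧ f zero) xor_) (∧-sumF x (f ∘ suc)))

sumF-∧ : ∀ {n} x (f : Fin n → Bool) → sumF f ∧ x ≡ sumF (λ i → f i ∧ x)
sumF-∧ {zero}  x f = refl
sumF-∧ {suc n} x f = trans (∧-distribʳ-xor x (f zero) _) (cong ((f zero ∧ x) xor_) (sumF-∧ x (f ∘ suc)))

sumF-comm : ∀ {n m} (f : Fin n → Fin m → Bool) →
  sumF (λ i → sumF (λ j → f i j)) ≡ sumF (λ j → sumF (λ i → f i j))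
sumF-comm {zero}  {m} f = sym (sumF-false m)
sumF-comm {suc n}     f =
  trans (cong (sumF (f zero) xor_) (sumF-comm (f ∘ suc))) (sym (sumF-xor (f zero) _))

sumF-δˡ : ∀ {n} (a : Fin n) (f : Fin n → Bool) → sumF (λ b → does (a ≟ b) ∧ f b) ≡ f a
sumF-δˡ {suc n} zero    f = trans (cong (f zero xor_) (sumF-false n)) (xor-identityʳ (f zero))
sumF-δˡ {suc n} (suc a) f = sumF-δˡ a (f ∘ suc)

sumF-δʳ : ∀ {n} (a : Fin n) (f : Fin n → Bool) → sumF (λ b → does (b ≟ a) ∧ f b) ≡ f a
sumF-δʳ {suc n} zero    f = trans (cong (f zero xor_) (sumF-false n)) (xor-identityʳ (f zero))
sumF-δʳ {suc n} (suc a) f = sumF-δʳ a (f ∘ suc)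

sumF-δ-toℕ : ∀ {n} m (f : ℕ → Bool) → m < n → sumF {n} (λ t → does (toℕ t ℕ.≟ m) ∧ f (toℕ t)) ≡ f m
sumF-δ-toℕ {suc n} zero    f _ = trans (cong (f zero xor_) (sumF-false n)) (xor-identityʳ (f zero))
sumF-δ-toℕ {suc n} (suc m) f (s≤s m<n) = sumF-δ-toℕ m (f ∘ suc) m<n

sumV-apply : ∀ {n m} (f : Fin n → Vec₂ m) a → sumV f a ≡ sumF (λ t → f t a)
sumV-apply {zero}  f a = refl
sumV-apply {suc n} f a = cong (f zero a xor_) (sumV-apply (f ∘ suc) a)

dot-charVec : ∀ {n} (u : Vec₂ n) s → dot u (charVec s) ≡ u s
dot-charVec u s = trans (sumF-cong (λ b → ∧-comm (u b) _)) (sumF-δʳ s u)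

·-cong : ∀ {n} (M : Mat₂ n) {u v : Vec₂ n} → (∀ b → u b ≡ v b) → ∀ a → (M · u) a ≡ (M · v) a
·-cong M u≗v a = sumF-cong (λ b → cong (M a b ∧_) (u≗v b))

idMat-· : ∀ {n} (v : Vec₂ n) a → (idMat · v) a ≡ v a
idMat-· v a = sumF-δˡ a v

·ₘ-· : ∀ {n} (M N : Mat₂ n) (v : Vec₂ n) a → ((M ·ₘ N) · v) a ≡ (M · (N · v)) a
·ₘ-· M N v a = begin
    sumF (λ c → sumF (λ b → M a b ∧ N b c) ∧ v c)
  ≡⟨ sumF-cong (λ c → sumF-∧ (v c) (λ b → M a b ∧ N b c)) ⟩
    sumF (λ c → sumF (λ b → (M a b ∧ N b c) ∧ v c))
  ≡⟨ sumF-cong (λ c → sumF-cong (λ b → ∧-assoc (M a b) (N b c) (v c))) ⟩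
    sumF (λ c → sumF (λ b → M a b ∧ (N b c ∧ v c)))
  ≡⟨ sumF-comm (λ c b → M a b ∧ (N b c ∧ v c)) ⟩
    sumF (λ b → sumF (λ c → M a b ∧ (N b c ∧ v c)))
  ≡⟨ sumF-cong (λ b → sym (∧-sumF (M a b) (λ c → N b c ∧ v c))) ⟩
    sumF (λ b → M a b ∧ sumF (λ c → N b c ∧ v c))
  ∎

flipMat-entry : ∀ {n} (R : Adj n) (s : Fin n) → R s s ≡ false → ∀ a b →
  flipMat R s a b ≡ does (a ≟ b) xor (does (b ≟ s) ∧ R a b)
flipMat-entry R s Rss≡false a b with a ≟ b
... | no _ = refl
... | yes refl with a ≟ s
...   | no _ = refl
...   | yes refl rewrite Rss≡false = refl

flipMat-· : ∀ {n} (R : Adj n) (s : Fin n) → R s s ≡ false → ∀ v a →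
  (flipMat R s · v) a ≡ v a xor (R a s ∧ v s)
flipMat-· R s Rss≡false v a = begin
    sumF (λ b → flipMat R s a b ∧ v b)
  ≡⟨ sumF-cong (λ b → cong (_∧ v b) (flipMat-entry R s Rss≡false a b)) ⟩
    sumF (λ b → (does (a ≟ b) xor (does (b ≟ s) ∧ R a b)) ∧ v b)
  ≡⟨ sumF-cong (λ b → ∧-distribʳ-xor (v b) (does (a ≟ b)) _) ⟩
    sumF (λ b → (does (a ≟ b) ∧ v b) xor ((does (b ≟ s) ∧ R a b) ∧ v b))
  ≡⟨ sumF-xor (λ b → does (a ≟ b) ∧ v b) (λ b → (does (b ≟ s) ∧ R a b) ∧ v b) ⟩
    sumF (λ b → does (a ≟ b) ∧ v b) xor sumF (λ b → (does (b ≟ s) ∧ R a b) ∧ v b)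
  ≡⟨ cong₂ _xor_ (sumF-δˡ a v)
       (trans (sumF-cong (λ b → ∧-assoc (does (b ≟ s)) (R a b) (v b))) (sumF-δʳ s (λ b → R a b ∧ v b))) ⟩
    v a xor (R a s ∧ v s)
  ∎

prodFlip-++-· : ∀ {n} (R : Adj n) (l m : List (Fin n)) (v : Vec₂ n) a →
  (prodFlip R (l ++ m) · v) a ≡ (prodFlip R m · (prodFlip R l · v)) a
prodFlip-++-· R []      m v = ·-cong (prodFlip R m) (λ b → sym (idMat-· v b))
prodFlip-++-· R (s ∷ l) m v a = begin
    ((prodFlip R (l ++ m) ·ₘ flipMat R s) · v) a
  ≡⟨ ·ₘ-· (prodFlip R (l ++ m)) (flipMat R s) v a ⟩
    (prodFlip R (l ++ m) · (flipMat R s · v)) a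
  ≡⟨ prodFlip-++-· R l m (flipMat R s · v) a ⟩
    (prodFlip R m · (prodFlip R l · (flipMat R s · v))) a
  ≡⟨ ·-cong (prodFlip R m) (λ b → sym (·ₘ-· (prodFlip R l) (flipMat R s) v b)) a ⟩
    (prodFlip R m · ((prodFlip R l ·ₘ flipMat R s) · v)) a
  ∎

-- walk R t is the paper's \overline{t+1}; unlike bar, its index t is an unbounded ℕ.
walk : ∀ {n} → Adj (suc n) → ℕ → Vec₂ (suc n)
walk {n} R t = prodFlip R (take t (allFin (suc n))) · charVec zero

walk-suc : ∀ {n} (R : Adj (suc n)) (i : Fin (suc n)) → R i i ≡ false → ∀ a →
  walk R (suc (toℕ i)) a ≡ walk R (toℕ i) a xor (R a i ∧ walk R (toℕ i) i)
walk-suc {n} R i Rii≡false a = begin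
    walk R (suc (toℕ i)) a
  ≡⟨ cong (λ l → (prodFlip R l · charVec zero) a) (take-suc-tabulate id i) ⟩
    (prodFlip R (first ++ i ∷ []) · charVec zero) a
  ≡⟨ prodFlip-++-· R first (i ∷ []) (charVec zero) a ⟩
    ((idMat ·ₘ flipMat R i) · walk R (toℕ i)) a
  ≡⟨ ·ₘ-· idMat (flipMat R i) (walk R (toℕ i)) a ⟩
    (idMat · (flipMat R i · walk R (toℕ i))) a
  ≡⟨ idMat-· (flipMat R i · walk R (toℕ i)) a ⟩
    (flipMat R i · walk R (toℕ i)) a
  ≡⟨ flipMat-· R i Rii≡false (walk R (toℕ i)) a ⟩
    walk R (toℕ i) a xor (R a i ∧ walk R (toℕ i) i)
  ∎
  where first = take (toℕ i) (allFin (suc n))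

-- The entry of e_{t-1} + e_t at the path position α.
pathPart : ℕ → ℕ → Bool
pathPart t α = does (t ℕ.≟ suc α) xor does (t ℕ.≟ α)

pathPart-diag : ∀ t → pathPart t t ≡ true
pathPart-diag t = cong₂ _xor_ (dec-false (t ℕ.≟ suc t) (ℕ.1+n≢n ∘ sym)) (dec-true (t ℕ.≟ t) refl)

pathPart-suc : ∀ t α →
  pathPart t α xor (does (t ℕ.≟ suc α) xor does (suc t ℕ.≟ α)) ≡ pathPart (suc t) α
pathPart-suc t α =
  trans (interchange x (does (t ℕ.≟ α)) x (does (suc t ℕ.≟ α)))
        (cong (_xor pathPart (suc t) α) (xor-same x))
  where x = does (t ℕ.≟ suc α)

sumF-pathPart : ∀ {n} α (f : ℕ → Bool) → suc α < n →
  sumF {n} (λ t → f (toℕ t) ∧ pathPart (toℕ t) α) ≡ f (suc α) xor f α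
sumF-pathPart {n} α f 1+α<n = begin
    sumF {n} (λ t → f (toℕ t) ∧ pathPart (toℕ t) α)
  ≡⟨ sumF-cong split ⟩
    sumF (λ t → at (suc α) t xor at α t)
  ≡⟨ sumF-xor (at (suc α)) (at α) ⟩
    sumF (at (suc α)) xor sumF (at α)
  ≡⟨ cong₂ _xor_ (sumF-δ-toℕ (suc α) f 1+α<n) (sumF-δ-toℕ α f (ℕ.<-trans (ℕ.n<1+n α) 1+α<n)) ⟩
    f (suc α) xor f α
  ∎
  where
  at : ℕ → Fin n → Bool
  at m t = does (toℕ t ℕ.≟ m) ∧ f (toℕ t)
  split : ∀ t → f (toℕ t) ∧ pathPart (toℕ t) α ≡ at (suc α) t xor at α t
  split t = trans (∧-comm (f (toℕ t)) (pathPart (toℕ t) α))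
                  (∧-distribʳ-xor (f (toℕ t)) (does (toℕ t ℕ.≟ suc α)) (does (toℕ t ℕ.≟ α)))

last-or-below : ∀ {n} (a : Fin (suc n)) → a ≡ fromℕ n ⊎ toℕ a < n
last-or-below {n} a with ℕ.m≤n⇒m<n∨m≡n (ℕ.≤-pred (toℕ<n a))
... | inj₁ a<n = inj₂ a<n
... | inj₂ a≡n = inj₁ (toℕ-injective (trans a≡n (sym (toℕ-fromℕ n))))

module InducedPathWalk (k : ℕ) (R : Adj (suc (suc k)))
                       (loopless : ∀ a → R a a ≡ false) (path : InducedPath k R) where

  N : Fin (suc (suc k))
  N = fromℕ (suc k)

  path-adjacency : ∀ a i → toℕ a < suc k → toℕ i < suc k →
    R a i ≡ does (toℕ i ℕ.≟ suc (toℕ a)) xor does (suc (toℕ i) ℕ.≟ toℕ a)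
  path-adjacency a i a<k i<k =
    ≡-does-xor-does (R a i) (toℕ i ℕ.≟ suc (toℕ a)) (suc (toℕ i) ℕ.≟ toℕ a)
      (Sum.map₂ sym ∘ proj₁ adjacent) (proj₂ adjacent ∘ Sum.map₂ sym)
      (λ (i≡1+a , 1+i≡a) → ℕ.m≢1+n+m (toℕ a) {1} (trans (sym 1+i≡a) (cong suc i≡1+a)))
    where adjacent = path a i a<k i<k

  walk-path-suc : ∀ {t} (i : Fin (suc (suc k))) → toℕ i ≡ t → t < suc k →
    (∀ a → toℕ a < suc k → walk R t a ≡ pathPart t (toℕ a)) →
    ∀ a → toℕ a < suc k → walk R (suc t) a ≡ pathPart (suc t) (toℕ a)
  walk-path-suc i refl i<k walk-path-t a a<k = begin
      walk R (suc t) a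
    ≡⟨ walk-suc R i (loopless i) a ⟩
      walk R t a xor (R a i ∧ walk R t i)
    ≡⟨ cong₂ (λ x y → x xor (R a i ∧ y))
             (walk-path-t a a<k) (trans (walk-path-t i i<k) (pathPart-diag t)) ⟩
      pathPart t α xor (R a i ∧ true)
    ≡⟨ cong (pathPart t α xor_) (trans (∧-identityʳ (R a i)) (path-adjacency a i a<k i<k)) ⟩
      pathPart t α xor (does (t ℕ.≟ suc α) xor does (suc t ℕ.≟ α))
    ≡⟨ pathPart-suc t α ⟩
      pathPart (suc t) α
    ∎
    where
    t = toℕ i
    α = toℕ a

  walk-path : ∀ t → t ≤ suc k → ∀ a → toℕ a < suc k → walk R t a ≡ pathPart t (toℕ a)
  walk-path zero _ a _ = trans (idMat-· (charVec zero) a) (charVec-zero a)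
    where
    charVec-zero : ∀ a → charVec zero a ≡ pathPart 0 (toℕ a)
    charVec-zero zero    = refl
    charVec-zero (suc a) = refl
  walk-path (suc t) (s≤s t≤k) =
    walk-path-suc (fromℕ< t<2+k) (toℕ-fromℕ< t<2+k) (s≤s t≤k) (walk-path t (ℕ.m≤n⇒m≤1+n t≤k))
    where t<2+k = s≤s (ℕ.m≤n⇒m≤1+n t≤k)

  Π₀-summand : Fin (suc (suc k)) → Fin (suc (suc k)) → Bool
  Π₀-summand a t = not (walk R (toℕ t) N) ∧ walk R (toℕ t) a

  Π₀-sum : ∀ a → sumV (λ t → if dot (bar R t) (charVec N) then zeroV else bar R t) a
               ≡ sumF (Π₀-summand a)
  Π₀-sum a =
    trans (sumV-apply (λ t → if dot (bar R t) (charVec N) then zeroV else bar R t) a) (sumF-cong term)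
    where
    term : ∀ t → (if dot (bar R t) (charVec N) then zeroV else bar R t) a ≡ Π₀-summand a t
    term t rewrite dot-charVec (bar R t) N =
      trans (if-float (λ (v : Vec₂ (suc (suc k))) → v a) (bar R t N)) (if-then-false (bar R t N) (bar R t a))

  Π₀-sum-last : sumF (Π₀-summand N) ≡ false
  Π₀-sum-last =
    trans (sumF-cong (λ (t : Fin (suc (suc k))) → ∧-inverseˡ (walk R (toℕ t) N))) (sumF-false (suc (suc k)))

  Π₀-sum-path : ∀ a → toℕ a < suc k → sumF (Π₀-summand a) ≡ R N a
  Π₀-sum-path a a<k = begin
      sumF (Π₀-summand a)
    ≡⟨ sumF-cong (λ t → cong (c (toℕ t) ∧_) (walk-path (toℕ t) (ℕ.≤-pred (toℕ<n t)) a a<k)) ⟩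
      sumF {suc (suc k)} (λ t → c (toℕ t) ∧ pathPart (toℕ t) α)
    ≡⟨ sumF-pathPart α c (s≤s a<k) ⟩
      not (walk R (suc α) N) xor not (walk R α N)
    ≡⟨ cong (λ x → not x xor not (walk R α N)) last-step ⟩
      not (walk R α N xor R N a) xor not (walk R α N)
    ≡⟨ not-xor-xor-not (walk R α N) (R N a) ⟩
      R N a
    ∎
    where
    α = toℕ a
    c : ℕ → Bool
    c s = not (walk R s N)
    last-step : walk R (suc α) N ≡ walk R α N xor R N a
    last-step = begin
        walk R (suc α) N
      ≡⟨ walk-suc R a (loopless a) N ⟩
        walk R α N xor (R N a ∧ walk R α a)
      ≡⟨ cong (λ y → walk R α N xor (R N a ∧ y))
              (trans (walk-path α α≤1+k a a<k) (pathPart-diag α)) ⟩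
        walk R α N xor (R N a ∧ true)
      ≡⟨ cong (walk R α N xor_) (∧-identityʳ (R N a)) ⟩
        walk R α N xor R N a
      ∎
      where α≤1+k = ℕ.m≤n⇒m≤1+n (ℕ.≤-pred a<k)

  neighbourhood-sum : ∀ a → sumV (λ j → if R N j then charVec j else zeroV) a ≡ R N a
  neighbourhood-sum a =
    trans (sumV-apply (λ j → if R N j then charVec j else zeroV) a) (trans (sumF-cong term) (sumF-δˡ a (R N)))
    where
    term : ∀ j → (if R N j then charVec j else zeroV) a ≡ does (a ≟ j) ∧ R N j
    term j = trans (if-float (λ (v : Vec₂ (suc (suc k))) → v a) (R N j))
                   (trans (if-else-false (R N j) _) (∧-comm (R N j) _))

lemma3p4 : (k : ℕ) (R : Adj (suc (suc k))) →
    IsSimple R → Connected R → InducedPath k R →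
    (a : Fin (suc (suc k))) →
    sumV (λ t → if dot (bar R t) (charVec (fromℕ (suc k))) then zeroV else bar R t) a
      ≡ sumV (λ j → if R (fromℕ (suc k)) j then charVec j else zeroV) a
lemma3p4 k R (_ , loopless) _ path a = begin
    sumV (λ t → if dot (bar R t) (charVec N) then zeroV else bar R t) a
  ≡⟨ Π₀-sum a ⟩
    sumF (Π₀-summand a)
  ≡⟨ coordinate (last-or-below a) ⟩
    R N a
  ≡⟨ neighbourhood-sum a ⟨
    sumV (λ j → if R N j then charVec j else zeroV) a
  ∎
  where
  open InducedPathWalk k R loopless path
  coordinate : a ≡ N ⊎ toℕ a < suc k → sumF (Π₀-summand a) ≡ R N a
  coordinate (inj₁ refl) = trans Π₀-sum-last (sym (loopless N))
  coordinate (inj₂ a<k)  = Π₀-sum-path a a<k
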